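{- Let $\alpha,\beta$ be coprime integers with $\beta(\alpha-8\beta)(\alpha+8\beta)\neq 0$, $a = \alpha+8\beta$, and $E: y^2 + axy + \beta a^2y = x^3 + \beta a x^2$. Let $p$ be an odd prime with $p \mid (\alpha-8\beta)$, and let $Q\in E(\overline{\mathbb{Q}})$ be a point with $x(Q) = -2^5\beta^2$ that is singular modulo $p$. Then $[2]Q$ does not reduce to the singular point modulo $p$.
   Context: When $p\mid(\alpha-8\beta)$, the reduction of $E$ modulo $p$ has its singular point at $(-2^5\beta^2, 2^7\beta^3)$. "Singular modulo $p$" means the reduction modulo a prime above $p$ is this singular point. -}

module Defs where

open import Level using (Level; _⊔_)
open import Algebra.Bundles using (CommutativeRing)
open import Data.Nat using (ℕ; zero; suc)
open import Data.Integer as ℤ using (ℤ; +_; -[1+_])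
open import Data.Product using (_×_; ∃; _,_)
open import Data.Sum using (_⊎_)
open import Relation.Nullary using (¬_)

module _ {c ℓ : Level} (K : CommutativeRing c ℓ) where
  open CommutativeRing K

  IsField : Set (c ⊔ ℓ)
  IsField = (¬ (1# ≈ 0#)) × (∀ x → ¬ (x ≈ 0#) → ∃ λ y → x * y ≈ 1#)

  ιℕ : ℕ → Carrier
  ιℕ zero    = 0#
  ιℕ (suc n) = 1# + ιℕ n

  ι : ℤ → Carrier
  ι (+ n)      = ιℕ n
  ι -[1+ n ]   = - ιℕ (suc n)

  CharZero : Set ℓ
  CharZero = ∀ n → ¬ (ιℕ (suc n) ≈ 0#)

  record IsValuationRing {o : Level} (O : Carrier → Set o) : Set (c ⊔ ℓ ⊔ o) where
    field
      resp   : ∀ {x y} → x ≈ y → O x → O y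
      one∈   : O 1#
      +-clo  : ∀ {x y} → O x → O y → O (x + y)
      neg-clo : ∀ {x} → O x → O (- x)
      *-clo  : ∀ {x y} → O x → O y → O (x * y)
      valuation : ∀ x → O x ⊎ (∃ λ y → O y × x * y ≈ 1#)

  InMax : {o : Level} → (Carrier → Set o) → Carrier → Set (c ⊔ ℓ ⊔ o)
  InMax O z = O z × ¬ (∃ λ w → O w × z * w ≈ 1#)

  -- the affine point (x , y) ∈ K² reduces modulo the prime (maximal ideal of O)
  -- to the point (s mod p , t mod p), where s t are integers
  ReducesTo : {o : Level} → (Carrier → Set o) → Carrier → Carrier → ℤ → ℤ → Set (c ⊔ ℓ ⊔ o)
  ReducesTo O x y s t = O x × O y × InMax O (x - ι s) × InMax O (y - ι t)

  coeffA : ℤ → ℤ → ℤ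
  coeffA α β = α ℤ.+ (+ 8) ℤ.* β

  -- E : y² + a x y + β a² y = x³ + β a x²   (a₁ = a, a₂ = β a, a₃ = β a², a₄ = a₆ = 0)
  OnE : ℤ → ℤ → Carrier → Carrier → Set ℓ
  OnE α β x y =
    y * y + A * x * y + B * A * A * y ≈ x * x * x + B * A * x * x
    where
      A = ι (coeffA α β)
      B = ι β

  -- (x₂ , y₂) is the affine point [2](x , y) on E (standard duplication formula;
  -- requires the tangent to be non-vertical, i.e. 2y + a₁x + a₃ ≠ 0,
  -- otherwise [2](x , y) is the point at infinity)
  IsDouble : ℤ → ℤ → Carrier → Carrier → Carrier → Carrier → Set (c ⊔ ℓ)
  IsDouble α β x y x₂ y₂ =
    ∃ λ lam →
      (¬ (den ≈ 0#)) ×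
      (lam * den ≈ num) ×
      (x₂ ≈ lam * lam + A * lam - B * A - ι (+ 2) * x) ×
      (y₂ ≈ - ((lam + A) * x₂) - (y - lam * x) - B * A * A)
    where
      A = ι (coeffA α β)
      B = ι β
      den = ι (+ 2) * y + A * x + B * A * A
      num = ι (+ 3) * x * x + ι (+ 2) * B * A * x - A * y

  singX : ℤ → ℤ
  singX β = ℤ.- ((+ 32) ℤ.* β ℤ.* β)

  singY : ℤ → ℤ
  singY β = (+ 128) ℤ.* β ℤ.* β ℤ.* β

-- Write ε = α − 8β, so that p ∣ ε and a = ε + 16β.  At x = −32β² the curve equation gives
-- D² = β²ε(ε − 16β)F for the tangent denominator D = 2y + ax + βa², while the slope λ satisfies
-- (2λ + a)D = βεG and 4(x₂ + 32β²) = (2λ + a)² + H, with F, G, H integer forms in ε and β.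
-- As D ≠ 0 one may cancel β²ε and eliminate λ, which yields 2¹⁸β⁵ = (x₂ + 32β²)Φ + εΨ with
-- Φ, Ψ ∈ ℤ[ε, β].  If [2]Q reduced to the singular point, x₂ + 32β² and ε would lie in the
-- maximal ideal, hence so would 2¹⁸β⁵; but 2 and β are units modulo p, since p is odd and
-- α ≡ 8β (mod p) with gcd(α, β) = 1.
{-# OPTIONS --safe #-}
module Submission where

open import Defs
open import Level using (Level)
open import Algebra.Bundles using (CommutativeRing)
open import Data.Nat as ℕ using (ℕ)
open import Data.Nat.Primality using (Prime)
import Data.Nat.Divisibility as ℕD
open import Data.Integer as ℤ using (ℤ; +_)
open import Data.Integer.Divisibility using (_∣_)
open import Data.Integer.Coprimality using (Coprime)
open import Relation.Binary.PropositionalEquality using (_≡_)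
open import Relation.Nullary using (¬_)

open import Data.Nat using (zero; suc; s≤s)
open import Data.Nat.DivMod using (_%_; _/_; m%n<n; m≡m%n+[m/n]*n)
import Data.Nat.Coprimality as ℕC
import Data.Nat.GCD as ℕG
open import Data.Integer using (-[1+_]; 1ℤ; -1ℤ; ∣_∣)
import Data.Integer.Properties as ℤP
import Data.Integer.Divisibility.Signed as ℤS
open import Data.Integer.Tactic.RingSolver using (solve-∀)
open import Data.Sign as Sign using (Sign)
open import Data.Fin using (zero; suc)
open import Data.Vec using (Vec; []; _∷_)
open import Data.Vec.Relation.Binary.Pointwise.Inductive as Pointwise using (Pointwise; []; _∷_)
open import Data.Vec.Relation.Unary.All using (All; []; _∷_)
open import Data.Vec.Relation.Unary.All.Properties using (lookup⁺)
open import Data.Maybe using (Maybe; just; nothing)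
open import Data.Product using (∃; ∃₂; _×_; _,_; proj₁; proj₂)
open import Data.Sum using (inj₁; inj₂)
open import Data.Empty using (⊥; ⊥-elim)
open import Relation.Nullary using (yes; no)
import Relation.Binary.PropositionalEquality as ≡
open import Algebra.Solver.Ring.AlmostCommutativeRing using (_-Raw-AlmostCommutative⟶_; fromCommutativeRing)
import Algebra.Solver.Ring

module _ where
  open import Data.Integer.Base using (_*_; _+_; _-_; -_)

  odd⇒1+q*2 : ∀ {p} → ¬ (2 ℕD.∣ p) → ∃ λ q → p ≡ 1 ℕ.+ q ℕ.* 2
  odd⇒1+q*2 {p} p-odd with p % 2 | m%n<n p 2 | m≡m%n+[m/n]*n p 2
  ... | 0           | _            | eq = ⊥-elim (p-odd (ℕD.divides (p / 2) eq))
  ... | 1           | _            | eq = p / 2 , eq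
  ... | suc (suc _) | s≤s (s≤s ()) | _

  odd⇒2-invertible-mod : ∀ {p} → ¬ (2 ℕD.∣ p) → ∃₂ λ u l → u * + 2 + l * + p ≡ 1ℤ
  odd⇒2-invertible-mod p-odd with odd⇒1+q*2 p-odd
  ... | q , ≡.refl = - + q , 1ℤ , (begin
    - + q * + 2 + 1ℤ * + (1 ℕ.+ q ℕ.* 2)  ≡⟨ ≡.cong (λ k → - + q * + 2 + 1ℤ * k) p≡1+2q ⟩
    - + q * + 2 + 1ℤ * (1ℤ + + q * + 2)  ≡⟨ cancel (+ q) ⟩
    1ℤ                                   ∎)
    where
    open ≡.≡-Reasoning
    p≡1+2q = ≡.trans (ℤP.pos-+ 1 (q ℕ.* 2)) (≡.cong (λ k → 1ℤ + k) (ℤP.pos-* q 2))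
    cancel : ∀ Q → - Q * + 2 + 1ℤ * (1ℤ + Q * + 2) ≡ 1ℤ
    cancel = solve-∀

  abs-as-multiple : ∀ i → ∃ λ s → s * i ≡ + ∣ i ∣
  abs-as-multiple (+ n)    = 1ℤ , ℤP.*-identityˡ (+ n)
  abs-as-multiple -[1+ n ] = -1ℤ , ℤP.-1*i≡-i -[1+ n ]

  pos-bézout⇒≡1 : ∀ x y m n → 1 ℕ.+ y ℕ.* n ≡ x ℕ.* m → + x * + m - + y * + n ≡ 1ℤ
  pos-bézout⇒≡1 x y m n eq = begin
    + x * + m - + y * + n            ≡⟨ ≡.cong₂ _-_ (ℤP.pos-* x m) (ℤP.pos-* y n) ⟨
    + (x ℕ.* m) - + (y ℕ.* n)        ≡⟨ ≡.cong (λ k → + k - + (y ℕ.* n)) eq ⟨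
    + (1 ℕ.+ y ℕ.* n) - + (y ℕ.* n)  ≡⟨ ≡.cong (_- + (y ℕ.* n)) (ℤP.pos-+ 1 (y ℕ.* n)) ⟩
    1ℤ + + (y ℕ.* n) - + (y ℕ.* n)   ≡⟨ cancel 1ℤ (+ (y ℕ.* n)) ⟩
    1ℤ                               ∎
    where
    open ≡.≡-Reasoning
    cancel : ∀ a b → a + b - b ≡ a
    cancel = solve-∀

  coprime⇒bézout : ∀ {i j} → Coprime i j → ∃₂ λ u v → u * i + v * j ≡ 1ℤ
  coprime⇒bézout {i} {j} coprime
    with abs-as-multiple i | abs-as-multiple j | ℕC.coprime-Bézout coprime
  ... | s , si | t , tj | ℕG.Bézout.+- x y eq = + x * s , - + y * t , (begin
    + x * s * i + - + y * t * j    ≡⟨ regroup (+ x) (+ y) s t i j ⟩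
    + x * (s * i) - + y * (t * j)  ≡⟨ ≡.cong₂ (λ a b → + x * a - + y * b) si tj ⟩
    + x * + ∣ i ∣ - + y * + ∣ j ∣  ≡⟨ pos-bézout⇒≡1 x y ∣ i ∣ ∣ j ∣ eq ⟩
    1ℤ                             ∎)
    where
    open ≡.≡-Reasoning
    regroup : ∀ X Y s t i j → X * s * i + - Y * t * j ≡ X * (s * i) - Y * (t * j)
    regroup = solve-∀
  ... | s , si | t , tj | ℕG.Bézout.-+ x y eq = - + x * s , + y * t , (begin
    - + x * s * i + + y * t * j    ≡⟨ regroup (+ x) (+ y) s t i j ⟩
    + y * (t * j) - + x * (s * i)  ≡⟨ ≡.cong₂ (λ a b → + y * b - + x * a) si tj ⟩
    + y * + ∣ j ∣ - + x * + ∣ i ∣  ≡⟨ pos-bézout⇒≡1 y x ∣ j ∣ ∣ i ∣ eq ⟩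
    1ℤ                             ∎)
    where
    open ≡.≡-Reasoning
    regroup : ∀ X Y s t i j → - X * s * i + Y * t * j ≡ Y * (t * j) - X * (s * i)
    regroup = solve-∀

  coprime⇒invertible-mod : ∀ {α β c m} → Coprime α β → m ∣ α - c * β →
                           ∃₂ λ w l → w * β + l * m ≡ 1ℤ
  coprime⇒invertible-mod {α} {β} {c} {m} coprime m∣α-cβ
    with coprime⇒bézout coprime | ℤS.∣ᵤ⇒∣ {m} {α - c * β} m∣α-cβ
  ... | u , v , bézout | ℤS.divides k α-cβ≡km = u * c + v , u * k , (begin
    (u * c + v) * β + u * k * m      ≡⟨ regroup u v c k β m ⟩
    u * (k * m + c * β) + v * β      ≡⟨ ≡.cong (λ t → u * (t + c * β) + v * β) α-cβ≡km ⟨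
    u * (α - c * β + c * β) + v * β  ≡⟨ cancel u v α β c ⟩
    u * α + v * β                    ≡⟨ bézout ⟩
    1ℤ                               ∎)
    where
    open ≡.≡-Reasoning
    regroup : ∀ u v c k β m → (u * c + v) * β + u * k * m ≡ u * (k * m + c * β) + v * β
    regroup = solve-∀
    cancel : ∀ u v α β c → u * (α - c * β + c * β) + v * β ≡ u * α + v * β
    cancel = solve-∀

module CommutativeRingLemmas {c ℓ : Level} (K : CommutativeRing c ℓ) where
  open CommutativeRing K
  open import Algebra.Properties.Ring ring using (-‿+-comm)
  open import Relation.Binary.Reasoning.Setoid setoid

  +-cancel-difference : ∀ x y z → (x + y) - (x + z) ≈ y - z
  +-cancel-difference x y z = begin
    (x + y) - (x + z)     ≈⟨ +-congˡ (-‿+-comm x z) ⟨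
    (x + y) + (- x - z)   ≈⟨ +-congʳ (+-comm x y) ⟩
    (y + x) + (- x - z)   ≈⟨ +-assoc y x (- x - z) ⟩
    y + (x + (- x - z))   ≈⟨ +-congˡ (+-assoc x (- x) (- z)) ⟨
    y + ((x - x) - z)     ≈⟨ +-congˡ (+-congʳ (-‿inverseʳ x)) ⟩
    y + (0# - z)          ≈⟨ +-congˡ (+-identityˡ (- z)) ⟩
    y - z                 ∎

  drop-vanishing : ∀ {u v S T k} → u ≈ v → T ≈ S + k * (u - v) → T ≈ S
  drop-vanishing {u} {v} {S} {T} {k} u≈v T≈ = begin
    T                ≈⟨ T≈ ⟩
    S + k * (u - v)  ≈⟨ +-congˡ (*-congˡ (+-congʳ u≈v)) ⟩
    S + k * (v - v)  ≈⟨ +-congˡ (*-congˡ (-‿inverseʳ v)) ⟩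
    S + k * 0#       ≈⟨ +-congˡ (zeroʳ k) ⟩
    S + 0#           ≈⟨ +-identityʳ S ⟩
    S                ∎

module IntegerImage {c ℓ : Level} (K : CommutativeRing c ℓ) where
  open CommutativeRing K
  open CommutativeRingLemmas K using (+-cancel-difference)
  open import Algebra.Properties.Ring ring using (-‿involutive; -0#≈0#; -‿+-comm; -1*x≈-x)
  open import Algebra.Properties.Semiring.Mult semiring using (×1-homo-*)
  open import Algebra.Properties.Semiring.Exp semiring using (^-congˡ)
  open import Algebra.Properties.Monoid.Mult +-monoid using (×-homo-+)
  open import Algebra.Definitions.RawMonoid +-rawMonoid using () renaming (_×_ to _⊠_)
  open import Algebra.Properties.CommutativeSemigroup *-commutativeSemigroup using (interchange)
  open import Relation.Binary.Reasoning.Setoid setoid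

  ιℕ≈⊠1# : ∀ n → ιℕ K n ≈ n ⊠ 1#
  ιℕ≈⊠1# zero    = refl
  ιℕ≈⊠1# (suc n) = +-congˡ (ιℕ≈⊠1# n)

  ιℕ-+ : ∀ m n → ιℕ K (m ℕ.+ n) ≈ ιℕ K m + ιℕ K n
  ιℕ-+ m n = begin
    ιℕ K (m ℕ.+ n)        ≈⟨ ιℕ≈⊠1# (m ℕ.+ n) ⟩
    (m ℕ.+ n) ⊠ 1#        ≈⟨ ×-homo-+ 1# m n ⟩
    m ⊠ 1# + n ⊠ 1#       ≈⟨ +-cong (ιℕ≈⊠1# m) (ιℕ≈⊠1# n) ⟨
    ιℕ K m + ιℕ K n       ∎

  ιℕ-* : ∀ m n → ιℕ K (m ℕ.* n) ≈ ιℕ K m * ιℕ K n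
  ιℕ-* m n = begin
    ιℕ K (m ℕ.* n)        ≈⟨ ιℕ≈⊠1# (m ℕ.* n) ⟩
    (m ℕ.* n) ⊠ 1#        ≈⟨ ×1-homo-* m n ⟩
    m ⊠ 1# * n ⊠ 1#       ≈⟨ *-cong (ιℕ≈⊠1# m) (ιℕ≈⊠1# n) ⟨
    ιℕ K m * ιℕ K n       ∎

  ι-neg : ∀ i → ι K (ℤ.- i) ≈ - ι K i
  ι-neg -[1+ n ]  = sym (-‿involutive _)
  ι-neg (+ zero)  = sym -0#≈0#
  ι-neg (+ suc n) = refl

  ι-⊖ : ∀ m n → ι K (m ℤ.⊖ n) ≈ ιℕ K m - ιℕ K n
  ι-⊖ zero    zero    = sym (-‿inverseʳ 0#)
  ι-⊖ zero    (suc n) = sym (+-identityˡ _)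
  ι-⊖ (suc m) zero    = sym (trans (+-congˡ -0#≈0#) (+-identityʳ _))
  ι-⊖ (suc m) (suc n) = begin
    ι K (suc m ℤ.⊖ suc n)           ≡⟨ ≡.cong (ι K) (ℤP.[1+m]⊖[1+n]≡m⊖n m n) ⟩
    ι K (m ℤ.⊖ n)                   ≈⟨ ι-⊖ m n ⟩
    ιℕ K m - ιℕ K n                 ≈⟨ +-cancel-difference 1# (ιℕ K m) (ιℕ K n) ⟨
    ιℕ K (suc m) - ιℕ K (suc n)     ∎

  ι-+ : ∀ i j → ι K (i ℤ.+ j) ≈ ι K i + ι K j
  ι-+ -[1+ m ] -[1+ n ] = begin
    - ιℕ K (suc (suc (m ℕ.+ n)))           ≈⟨ -‿cong (+-congˡ (ιℕ-+ (suc m) n)) ⟩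
    - (1# + (ιℕ K (suc m) + ιℕ K n))       ≈⟨ -‿cong (+-congˡ (+-comm _ _)) ⟩
    - (1# + (ιℕ K n + ιℕ K (suc m)))       ≈⟨ -‿cong (+-assoc _ _ _) ⟨
    - (ιℕ K (suc n) + ιℕ K (suc m))        ≈⟨ -‿cong (+-comm _ _) ⟩
    - (ιℕ K (suc m) + ιℕ K (suc n))        ≈⟨ -‿+-comm _ _ ⟨
    - ιℕ K (suc m) - ιℕ K (suc n)          ∎
  ι-+ -[1+ m ] (+ n)    = trans (ι-⊖ n (suc m)) (+-comm _ _)
  ι-+ (+ m)    -[1+ n ] = ι-⊖ m (suc n)
  ι-+ (+ m)    (+ n)    = ιℕ-+ m n

  ιSign : Sign → Carrier
  ιSign Sign.+ = 1#
  ιSign Sign.- = - 1#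

  ιSign-* : ∀ s t → ιSign (s Sign.* t) ≈ ιSign s * ιSign t
  ιSign-* Sign.- Sign.- = sym (trans (-1*x≈-x (- 1#)) (-‿involutive 1#))
  ιSign-* Sign.- Sign.+ = sym (*-identityʳ _)
  ιSign-* Sign.+ Sign.- = sym (*-identityˡ _)
  ιSign-* Sign.+ Sign.+ = sym (*-identityˡ _)

  ι-◃ : ∀ s n → ι K (s ℤ.◃ n) ≈ ιSign s * ιℕ K n
  ι-◃ s       zero    = sym (zeroʳ _)
  ι-◃ Sign.+ (suc n) = sym (*-identityˡ _)
  ι-◃ Sign.- (suc n) = sym (-1*x≈-x _)

  ι-signAbs : ∀ i → ι K i ≈ ιSign (ℤ.sign i) * ιℕ K ℤ.∣ i ∣
  ι-signAbs i = trans (reflexive (≡.cong (ι K) (≡.sym (ℤP.◃-inverse i)))) (ι-◃ (ℤ.sign i) ℤ.∣ i ∣)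

  ι-* : ∀ i j → ι K (i ℤ.* j) ≈ ι K i * ι K j
  ι-* i j = begin
    ι K (i ℤ.* j)                          ≈⟨ ι-◃ (s Sign.* t) (m ℕ.* n) ⟩
    ιSign (s Sign.* t) * ιℕ K (m ℕ.* n)    ≈⟨ *-cong (ιSign-* s t) (ιℕ-* m n) ⟩
    (ιSign s * ιSign t) * (ιℕ K m * ιℕ K n) ≈⟨ interchange _ _ _ _ ⟩
    (ιSign s * ιℕ K m) * (ιSign t * ιℕ K n) ≈⟨ *-cong (ι-signAbs i) (ι-signAbs j) ⟨
    ι K i * ι K j                          ∎
    where
    s = ℤ.sign i
    t = ℤ.sign j
    m = ℤ.∣ i ∣
    n = ℤ.∣ j ∣

  ι1≈1 : ι K (+ 1) ≈ 1#
  ι1≈1 = +-identityʳ 1#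

  ι-homomorphism : CommutativeRing.rawRing ℤP.+-*-commutativeRing -Raw-AlmostCommutative⟶ fromCommutativeRing K
  ι-homomorphism = record
    { ⟦_⟧ = ι K ; +-homo = ι-+ ; *-homo = ι-* ; -‿homo = ι-neg ; 0-homo = refl ; 1-homo = ι1≈1 }

  ι-≈? : ∀ i j → Maybe (ι K i ≈ ι K j)
  ι-≈? i j with i ℤ.≟ j
  ... | yes i≡j = just (reflexive (≡.cong (ι K) i≡j))
  ... | no _    = nothing

  module ℤ-Solver = Algebra.Solver.Ring _ _ ι-homomorphism ι-≈?

  open ℤ-Solver using (Polynomial; ⟦_⟧)

  ⟦⟧-cong : ∀ {n} (p : Polynomial n) {ρ ρ′ : Vec Carrier n} → Pointwise _≈_ ρ ρ′ → ⟦ p ⟧ ρ ≈ ⟦ p ⟧ ρ′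
  ⟦⟧-cong (ℤ-Solver.op ℤ-Solver.[+] p q) ρ≈ρ′ = +-cong (⟦⟧-cong p ρ≈ρ′) (⟦⟧-cong q ρ≈ρ′)
  ⟦⟧-cong (ℤ-Solver.op ℤ-Solver.[*] p q) ρ≈ρ′ = *-cong (⟦⟧-cong p ρ≈ρ′) (⟦⟧-cong q ρ≈ρ′)
  ⟦⟧-cong (ℤ-Solver.con c)   ρ≈ρ′ = refl
  ⟦⟧-cong (ℤ-Solver.var i)   ρ≈ρ′ = Pointwise.lookup ρ≈ρ′ i
  ⟦⟧-cong (p ℤ-Solver.:^ k)  ρ≈ρ′ = ^-congˡ k (⟦⟧-cong p ρ≈ρ′)
  ⟦⟧-cong (ℤ-Solver.:- p)    ρ≈ρ′ = -‿cong (⟦⟧-cong p ρ≈ρ′)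

module ValuationRingFacts {c ℓ o : Level} (K : CommutativeRing c ℓ) (K-field : IsField K)
  (O : CommutativeRing.Carrier K → Set o) (O-valuation : IsValuationRing K O) where
  open CommutativeRing K
  open IsValuationRing O-valuation
  open CommutativeRingLemmas K using (drop-vanishing)
  open IntegerImage K
  open ℤ-Solver using (Polynomial; ⟦_⟧; solve; _:=_; con; _:+_; _:*_; _:-_; :-_)
  open import Algebra.Properties.Semiring.Exp semiring using (_^_)
  open import Relation.Binary.Reasoning.Setoid setoid

  𝔪 : Carrier → Set _
  𝔪 = InMax K O

  0∈O : O 0#
  0∈O = resp (-‿inverseʳ 1#) (+-clo one∈ (neg-clo one∈))

  ιℕ∈O : ∀ n → O (ιℕ K n)
  ιℕ∈O zero    = 0∈O
  ιℕ∈O (suc n) = +-clo one∈ (ιℕ∈O n)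

  ι∈O : ∀ i → O (ι K i)
  ι∈O (+ n)      = ιℕ∈O n
  ι∈O -[1+ n ]   = neg-clo (ιℕ∈O (suc n))

  ⟦⟧∈O : ∀ {n} (p : Polynomial n) {ρ : Vec Carrier n} → All O ρ → O (⟦ p ⟧ ρ)
  ⟦⟧∈O (ℤ-Solver.op ℤ-Solver.[+] p q) ρ⊆O = +-clo (⟦⟧∈O p ρ⊆O) (⟦⟧∈O q ρ⊆O)
  ⟦⟧∈O (ℤ-Solver.op ℤ-Solver.[*] p q) ρ⊆O = *-clo (⟦⟧∈O p ρ⊆O) (⟦⟧∈O q ρ⊆O)
  ⟦⟧∈O (ℤ-Solver.con c)       ρ⊆O = ι∈O c
  ⟦⟧∈O (ℤ-Solver.var i)       ρ⊆O = lookup⁺ ρ⊆O i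
  ⟦⟧∈O (p ℤ-Solver.:^ zero)   ρ⊆O = one∈
  ⟦⟧∈O (p ℤ-Solver.:^ suc k)  ρ⊆O = *-clo (⟦⟧∈O p ρ⊆O) (⟦⟧∈O (p ℤ-Solver.:^ k) ρ⊆O)
  ⟦⟧∈O (ℤ-Solver.:- p)        ρ⊆O = neg-clo (⟦⟧∈O p ρ⊆O)

  𝔪-resp : ∀ {x y} → x ≈ y → 𝔪 x → 𝔪 y
  𝔪-resp x≈y (x∈O , x-nonunit) =
    resp x≈y x∈O , λ (w , w∈O , yw≈1) → x-nonunit (w , w∈O , trans (*-congʳ x≈y) yw≈1)

  𝔪-*ʳ : ∀ {x t} → 𝔪 x → O t → 𝔪 (x * t)
  𝔪-*ʳ {x} {t} (x∈O , x-nonunit) t∈O =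
    *-clo x∈O t∈O , λ (w , w∈O , xtw≈1) → x-nonunit (t * w , *-clo t∈O w∈O , trans (sym (*-assoc x t w)) xtw≈1)

  𝔪-*ˡ : ∀ {x t} → O t → 𝔪 x → 𝔪 (t * x)
  𝔪-*ˡ t∈O x∈𝔪 = 𝔪-resp (*-comm _ _) (𝔪-*ʳ x∈𝔪 t∈O)

  1∉𝔪 : ¬ 𝔪 1#
  1∉𝔪 (_ , 1-nonunit) = 1-nonunit (1# , one∈ , *-identityʳ 1#)

  -- Locality of a valuation ring: t/s or s/t lies in O, so s or t divides t + s in O,
  -- and a unit t + s would make s or t a unit.
  sum-of-nonunits-nonunit : ∀ {t s w} → 𝔪 t → 𝔪 s → O w → (t + s) * w ≈ 1# → ⊥
  sum-of-nonunits-nonunit {t} {s} {w} (_ , t-nonunit) (_ , s-nonunit) w∈O [t+s]w≈1 = s≉0⇒⊥ s≈0⇒⊥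
    where
    s≈0⇒⊥ : ¬ s ≈ 0#
    s≈0⇒⊥ s≈0 = t-nonunit (w , w∈O , trans (*-congʳ (sym t+s≈t)) [t+s]w≈1)
      where t+s≈t = trans (+-congˡ s≈0) (+-identityʳ t)
    s≉0⇒⊥ : ¬ ¬ s ≈ 0#
    s≉0⇒⊥ s≉0 with proj₂ K-field s s≉0
    ... | s⁻¹ , ss⁻¹≈1 with valuation (t * s⁻¹) | trans ss⁻¹≈1 (sym ι1≈1)
    ... | inj₁ t/s∈O | ss⁻¹≈ι1 = s-nonunit
      ((ι K (+ 1) + t * s⁻¹) * w , *-clo (+-clo (ι∈O (+ 1)) t/s∈O) w∈O ,
       trans (drop-vanishing ss⁻¹≈ι1 (solve 4 (λ t s s⁻¹ w →
                s :* ((con (+ 1) :+ t :* s⁻¹) :* w)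
             := (t :+ s) :* w :+ (t :* w) :* (s :* s⁻¹ :- con (+ 1))) refl t s s⁻¹ w))
             [t+s]w≈1)
    ... | inj₂ (y , y∈O , t/s·y≈1) | ss⁻¹≈ι1 = t-nonunit
      ((ι K (+ 1) + y) * w , *-clo (+-clo (ι∈O (+ 1)) y∈O) w∈O ,
       trans (drop-vanishing ss⁻¹≈ι1 (drop-vanishing (trans t/s·y≈1 (sym ι1≈1)) (solve 5 (λ t s s⁻¹ y w →
                t :* ((con (+ 1) :+ y) :* w)
             := ((t :+ s) :* w :+ (:- (t :* y :* w)) :* (s :* s⁻¹ :- con (+ 1)))
                :+ (s :* w) :* (t :* s⁻¹ :* y :- con (+ 1))) refl t s s⁻¹ y w)))
             [t+s]w≈1)

  𝔪-+ : ∀ {t s} → 𝔪 t → 𝔪 s → 𝔪 (t + s)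
  𝔪-+ t∈𝔪 s∈𝔪 = +-clo (proj₁ t∈𝔪) (proj₁ s∈𝔪) , λ (w , w∈O , [t+s]w≈1) → sum-of-nonunits-nonunit t∈𝔪 s∈𝔪 w∈O [t+s]w≈1

  ι-divisible∈𝔪 : ∀ {m i} → 𝔪 (ι K m) → m ∣ i → 𝔪 (ι K i)
  ι-divisible∈𝔪 {m} {i} m∈𝔪 m∣i with ℤS.∣ᵤ⇒∣ {m} {i} m∣i
  ... | ℤS.divides k i≡km = 𝔪-resp (sym ι-i≈) (𝔪-*ˡ (ι∈O k) m∈𝔪)
    where ι-i≈ = trans (reflexive (≡.cong (ι K) i≡km)) (ι-* k m)

  0∈𝔪 : 𝔪 0#
  0∈𝔪 = 0∈O , λ (w , _ , 0w≈1) → proj₁ K-field (trans (sym 0w≈1) (zeroˡ w))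

  ResidueUnit : Carrier → Set _
  ResidueUnit x = O x × ∃ λ w → O w × 𝔪 (1# - x * w)

  residueUnit⇒∉𝔪 : ∀ {x} → ResidueUnit x → ¬ 𝔪 x
  residueUnit⇒∉𝔪 {x} (_ , w , w∈O , 1-xw∈𝔪) x∈𝔪 =
    1∉𝔪 (𝔪-resp xw+[1-xw]≈1 (𝔪-+ (𝔪-*ʳ x∈𝔪 w∈O) 1-xw∈𝔪))
    where
    xw+[1-xw]≈1 : x * w + (1# - x * w) ≈ 1#
    xw+[1-xw]≈1 = begin
      x * w + (1# - x * w)    ≈⟨ +-comm _ _ ⟩
      (1# - x * w) + x * w    ≈⟨ +-assoc _ _ _ ⟩
      1# + (- (x * w) + x * w) ≈⟨ +-congˡ (-‿inverseˡ _) ⟩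
      1# + 0#                 ≈⟨ +-identityʳ 1# ⟩
      1#                      ∎

  residueUnit-1 : ResidueUnit 1#
  residueUnit-1 = one∈ , 1# , one∈ , 𝔪-resp 0≈1-1·1 0∈𝔪
    where 0≈1-1·1 = sym (trans (+-congˡ (-‿cong (*-identityʳ 1#))) (-‿inverseʳ 1#))

  residueUnit-* : ∀ {x y} → ResidueUnit x → ResidueUnit y → ResidueUnit (x * y)
  residueUnit-* {x} {y} (x∈O , w , w∈O , 1-xw∈𝔪) (y∈O , v , v∈O , 1-yv∈𝔪) =
    *-clo x∈O y∈O , w * v , *-clo w∈O v∈O ,
    𝔪-resp (sym expand) (𝔪-+ 1-xw∈𝔪 (𝔪-*ˡ (*-clo x∈O w∈O) 1-yv∈𝔪))
    where
    expand : 1# - (x * y) * (w * v) ≈ (1# - x * w) + (x * w) * (1# - y * v)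
    expand = begin
      1# - (x * y) * (w * v)                                  ≈⟨ +-congʳ ι1≈1 ⟨
      ι K (+ 1) - (x * y) * (w * v)                           ≈⟨ solve 4 (λ x y w v →
        con (+ 1) :- (x :* y) :* (w :* v) := (con (+ 1) :- x :* w) :+ (x :* w) :* (con (+ 1) :- y :* v)) refl x y w v ⟩
      (ι K (+ 1) - x * w) + (x * w) * (ι K (+ 1) - y * v)     ≈⟨ +-cong (+-congʳ ι1≈1) (*-congˡ (+-congʳ ι1≈1)) ⟩
      (1# - x * w) + (x * w) * (1# - y * v)                   ∎

  residueUnit-^ : ∀ {x} → ResidueUnit x → ∀ n → ResidueUnit (x ^ n)
  residueUnit-^ x-unit zero    = residueUnit-1
  residueUnit-^ x-unit (suc n) = residueUnit-* x-unit (residueUnit-^ x-unit n)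

  combination∈𝔪 : ∀ {t u ε b} → 𝔪 u → 𝔪 ε → O b →
    (∃₂ λ (Φ Ψ : Polynomial 2) → t ≈ u * ⟦ Φ ⟧ (ε ∷ b ∷ []) + ε * ⟦ Ψ ⟧ (ε ∷ b ∷ [])) → 𝔪 t
  combination∈𝔪 u∈𝔪 ε∈𝔪 b∈O (Φ , Ψ , t≈) =
    𝔪-resp (sym t≈) (𝔪-+ (𝔪-*ʳ u∈𝔪 (⟦⟧∈O Φ εb⊆O)) (𝔪-*ʳ ε∈𝔪 (⟦⟧∈O Ψ εb⊆O)))
    where εb⊆O = proj₁ ε∈𝔪 ∷ b∈O ∷ []

  residueUnit-ι : ∀ {m i} → 𝔪 (ι K m) → (∃₂ λ u l → u ℤ.* i ℤ.+ l ℤ.* m ≡ 1ℤ) → ResidueUnit (ι K i)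
  residueUnit-ι {m} {i} m∈𝔪 (u , l , bézout) =
    ι∈O i , ι K u , ι∈O u , 𝔪-resp lm≈1-iu (𝔪-*ˡ (ι∈O l) m∈𝔪)
    where
    lm≈1-iu : ι K l * ι K m ≈ 1# - ι K i * ι K u
    lm≈1-iu = begin
      ι K l * ι K m                                         ≈⟨ solve 4 (λ i u l m →
        l :* m := (u :* i :+ l :* m) :- i :* u) refl (ι K i) (ι K u) (ι K l) (ι K m) ⟩
      (ι K u * ι K i + ι K l * ι K m) - ι K i * ι K u       ≈⟨ +-congʳ (trans (ι-+ (u ℤ.* i) (l ℤ.* m)) (+-cong (ι-* u i) (ι-* l m))) ⟨
      ι K (u ℤ.* i ℤ.+ l ℤ.* m) - ι K i * ι K u             ≡⟨ ≡.cong (λ k → ι K k - ι K i * ι K u) bézout ⟩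
      ι K 1ℤ - ι K i * ι K u                                ≈⟨ +-congʳ ι1≈1 ⟩
      1# - ι K i * ι K u                                    ∎

module SingularDoubling {c ℓ : Level} (K : CommutativeRing c ℓ) (K-field : IsField K) where
  open CommutativeRing K hiding (zero)
  open CommutativeRingLemmas K using (drop-vanishing)
  open IntegerImage K
  open ℤ-Solver using (Polynomial; ⟦_⟧; prove; con; var; _:+_; _:*_; _:-_; :-_; _:^_)
  open import Algebra.Properties.Semiring.Exp semiring using (_^_)
  open import Relation.Binary.Reasoning.Setoid setoid

  *-cancelˡ-nonzero : ∀ {a u v} → ¬ a ≈ 0# → a * u ≈ a * v → u ≈ v
  *-cancelˡ-nonzero {a} {u} {v} a≉0 au≈av with proj₂ K-field a a≉0
  ... | a⁻¹ , aa⁻¹≈1 = begin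
    u                ≈⟨ *-identityˡ u ⟨
    1# * u           ≈⟨ *-congʳ aa⁻¹≈1 ⟨
    (a * a⁻¹) * u    ≈⟨ *-congʳ (*-comm a a⁻¹) ⟩
    (a⁻¹ * a) * u    ≈⟨ *-assoc a⁻¹ a u ⟩
    a⁻¹ * (a * u)    ≈⟨ *-congˡ au≈av ⟩
    a⁻¹ * (a * v)    ≈⟨ *-assoc a⁻¹ a v ⟨
    (a⁻¹ * a) * v    ≈⟨ *-congʳ (*-comm a⁻¹ a) ⟩
    (a * a⁻¹) * v    ≈⟨ *-congʳ aa⁻¹≈1 ⟩
    1# * v           ≈⟨ *-identityˡ v ⟩
    v                ∎

  *-nonzero : ∀ {u v} → ¬ u ≈ 0# → ¬ v ≈ 0# → ¬ u * v ≈ 0#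
  *-nonzero {u} {v} u≉0 v≉0 uv≈0 = v≉0 (*-cancelˡ-nonzero u≉0 (trans uv≈0 (sym (zeroʳ u))))

  -- The shapes of OnE and IsDouble in Defs, so that their hypotheses are evaluations of these.
  module _ {n : ℕ} where
    curveˡ curveʳ tangentDen tangentNum : (a b x y : Polynomial n) → Polynomial n
    curveˡ     a b x y = y :* y :+ a :* x :* y :+ b :* a :* a :* y
    curveʳ     a b x y = x :* x :* x :+ b :* a :* x :* x
    tangentDen a b x y = con (+ 2) :* y :+ a :* x :+ b :* a :* a
    tangentNum a b x y = con (+ 3) :* x :* x :+ con (+ 2) :* b :* a :* x :- a :* y

    doubleX : (a b x m : Polynomial n) → Polynomial n
    doubleX a b x m = m :* m :+ a :* m :- b :* a :- con (+ 2) :* x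

    singularX : (b : Polynomial n) → Polynomial n
    singularX b = :- (con (+ 32) :* b :* b)

  -- Forms in e = α - 8β (so a = e + 16β) and b = β.
  module _ {n : ℕ} (e b : Polynomial n) where
    shiftedA d F G H R Φ Ψ : Polynomial n
    shiftedA  = e :+ con (+ 16) :* b
    d = e :- con (+ 16) :* b
    F = e :* e :+ con (+ 16) :* b :* e :- con (+ 256) :* b :* b
    G = e :* e :+ con (+ 16) :* b :* e :- con (+ 384) :* b :* b
    H = con (+ 64) :* b :* b :- con (+ 36) :* b :* e :- e :* e
    R = :- (con (+ 180224) :* b :* b :* b :* b) :+ con (+ 14336) :* b :* b :* b :* e
        :+ con (+ 576) :* b :* b :* e :* e :- con (+ 36) :* b :* e :* e :* e :- e :* e :* e :* e
    Φ = con (+ 4) :* d :* F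
    Ψ = :- (G :* G :+ R)

  module AtSingularX (ε b y m x₂ : Carrier) where
    env : Vec Carrier 5
    env = ε ∷ b ∷ y ∷ m ∷ x₂ ∷ []

    ⟪_⟫ : Polynomial 5 → Carrier
    ⟪ p ⟫ = ⟦ p ⟧ env

    𝛆 𝐛 𝐲 𝐦 𝐱₂ 𝐚 𝐱₀ 𝐃 𝐍 𝐯 𝐳 𝐜 𝐝𝐅 𝐆 𝐇 : Polynomial 5
    𝛆  = var zero
    𝐛  = var (suc zero)
    𝐲  = var (suc (suc zero))
    𝐦  = var (suc (suc (suc zero)))
    𝐱₂ = var (suc (suc (suc (suc zero))))
    𝐚  = shiftedA 𝛆 𝐛
    𝐱₀ = singularX 𝐛
    𝐃  = tangentDen 𝐚 𝐛 𝐱₀ 𝐲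
    𝐍  = tangentNum 𝐚 𝐛 𝐱₀ 𝐲
    𝐯  = con (+ 2) :* 𝐦 :+ 𝐚
    𝐳  = 𝐱₂ :- 𝐱₀
    𝐜  = 𝐛 :* 𝐛 :* 𝛆
    𝐝𝐅 = d 𝛆 𝐛 :* F 𝛆 𝐛
    𝐆  = G 𝛆 𝐛
    𝐇  = H 𝛆 𝐛

    tangentDen² : ⟪ curveˡ 𝐚 𝐛 𝐱₀ 𝐲 ⟫ ≈ ⟪ curveʳ 𝐚 𝐛 𝐱₀ 𝐲 ⟫ → ⟪ 𝐃 :* 𝐃 ⟫ ≈ ⟪ 𝐜 :* 𝐝𝐅 ⟫
    tangentDen² on-curve = drop-vanishing on-curve (prove env (𝐃 :* 𝐃)
      (𝐜 :* 𝐝𝐅 :+ con (+ 4) :* (curveˡ 𝐚 𝐛 𝐱₀ 𝐲 :- curveʳ 𝐚 𝐛 𝐱₀ 𝐲)) refl)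

    tangentDen-slope : ⟪ 𝐦 :* 𝐃 ⟫ ≈ ⟪ 𝐍 ⟫ → ⟪ 𝐯 :* 𝐃 ⟫ ≈ ⟪ 𝐛 :* 𝛆 :* 𝐆 ⟫
    tangentDen-slope slope = drop-vanishing slope (prove env (𝐯 :* 𝐃)
      (𝐛 :* 𝛆 :* 𝐆 :+ con (+ 2) :* (𝐦 :* 𝐃 :- 𝐍)) refl)

    doubleX-shift : ⟪ 𝐱₂ ⟫ ≈ ⟪ doubleX 𝐚 𝐛 𝐱₀ 𝐦 ⟫ → ⟪ con (+ 4) :* 𝐳 ⟫ ≈ ⟪ 𝐯 :* 𝐯 :+ 𝐇 ⟫
    doubleX-shift x₂≈ = drop-vanishing x₂≈ (prove env (con (+ 4) :* 𝐳)
      (𝐯 :* 𝐯 :+ 𝐇 :+ con (+ 4) :* (𝐱₂ :- doubleX 𝐚 𝐛 𝐱₀ 𝐦)) refl)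

    slope-eliminated : ⟪ curveˡ 𝐚 𝐛 𝐱₀ 𝐲 ⟫ ≈ ⟪ curveʳ 𝐚 𝐛 𝐱₀ 𝐲 ⟫ → ¬ ⟪ 𝐃 ⟫ ≈ 0# → ⟪ 𝐦 :* 𝐃 ⟫ ≈ ⟪ 𝐍 ⟫ →
                       ⟪ 𝐯 :* 𝐯 :* 𝐝𝐅 ⟫ ≈ ⟪ 𝛆 :* (𝐆 :* 𝐆) ⟫
    slope-eliminated on-curve D≉0 slope = *-cancelˡ-nonzero c≉0 (begin
      ⟪ 𝐜 :* (𝐯 :* 𝐯 :* 𝐝𝐅) ⟫              ≈⟨ prove env (𝐜 :* (𝐯 :* 𝐯 :* 𝐝𝐅)) ((𝐯 :* 𝐯) :* (𝐜 :* 𝐝𝐅)) refl ⟩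
      ⟪ (𝐯 :* 𝐯) :* (𝐜 :* 𝐝𝐅) ⟫            ≈⟨ *-congˡ D² ⟨
      ⟪ (𝐯 :* 𝐯) :* (𝐃 :* 𝐃) ⟫            ≈⟨ prove env ((𝐯 :* 𝐯) :* (𝐃 :* 𝐃)) ((𝐯 :* 𝐃) :* (𝐯 :* 𝐃)) refl ⟩
      ⟪ (𝐯 :* 𝐃) :* (𝐯 :* 𝐃) ⟫            ≈⟨ *-cong vD vD ⟩
      ⟪ (𝐛 :* 𝛆 :* 𝐆) :* (𝐛 :* 𝛆 :* 𝐆) ⟫  ≈⟨ prove env ((𝐛 :* 𝛆 :* 𝐆) :* (𝐛 :* 𝛆 :* 𝐆)) (𝐜 :* (𝛆 :* (𝐆 :* 𝐆))) refl ⟩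
      ⟪ 𝐜 :* (𝛆 :* (𝐆 :* 𝐆)) ⟫             ∎)
      where
      D² = tangentDen² on-curve
      vD = tangentDen-slope slope
      -- D² = β²ε·dF and D ≠ 0.
      c≉0 : ¬ ⟪ 𝐜 ⟫ ≈ 0#
      c≉0 c≈0 = *-nonzero D≉0 D≉0 (trans D² (trans (*-congʳ c≈0) (zeroˡ _)))

    eliminant : ⟪ curveˡ 𝐚 𝐛 𝐱₀ 𝐲 ⟫ ≈ ⟪ curveʳ 𝐚 𝐛 𝐱₀ 𝐲 ⟫ → ¬ ⟪ 𝐃 ⟫ ≈ 0# → ⟪ 𝐦 :* 𝐃 ⟫ ≈ ⟪ 𝐍 ⟫ →
                ⟪ 𝐱₂ ⟫ ≈ ⟪ doubleX 𝐚 𝐛 𝐱₀ 𝐦 ⟫ →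
                ⟪ con (+ 2) :^ 18 :* 𝐛 :^ 5 ⟫ ≈ ⟪ 𝐳 :* Φ 𝛆 𝐛 :+ 𝛆 :* Ψ 𝛆 𝐛 ⟫
    eliminant on-curve D≉0 slope x₂≈ =
      drop-vanishing (doubleX-shift x₂≈) (drop-vanishing (slope-eliminated on-curve D≉0 slope)
        (prove env (con (+ 2) :^ 18 :* 𝐛 :^ 5)
          (𝐳 :* Φ 𝛆 𝐛 :+ 𝛆 :* Ψ 𝛆 𝐛
            :+ (:- 𝐝𝐅) :* (con (+ 4) :* 𝐳 :- (𝐯 :* 𝐯 :+ 𝐇))
            :+ (:- con (+ 1)) :* (𝐯 :* 𝐯 :* 𝐝𝐅 :- 𝛆 :* (𝐆 :* 𝐆))) refl))

  doubling-eliminant : ∀ {ε b a x y m x₂} →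
    a ≈ ε + ι K (+ 16) * b → x ≈ - (ι K (+ 32) * b * b) →
    y * y + a * x * y + b * a * a * y ≈ x * x * x + b * a * x * x →
    ¬ (ι K (+ 2) * y + a * x + b * a * a ≈ 0#) →
    m * (ι K (+ 2) * y + a * x + b * a * a) ≈ ι K (+ 3) * x * x + ι K (+ 2) * b * a * x - a * y →
    x₂ ≈ m * m + a * m - b * a - ι K (+ 2) * x →
    ∃₂ λ (Φ Ψ : Polynomial 2) →
      ι K (+ 2) ^ 18 * b ^ 5 ≈ (x₂ - x) * ⟦ Φ ⟧ (ε ∷ b ∷ []) + ε * ⟦ Ψ ⟧ (ε ∷ b ∷ [])
  doubling-eliminant {ε} {b} {a} {x} {y} {m} {x₂} a≈ x≈ on-curve D≉0 slope x₂≈ =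
    Φ (var zero) (var (suc zero)) , Ψ (var zero) (var (suc zero)) ,
    trans (AtSingularX.eliminant ε b y m x₂
             (substitute (curveˡ 𝐚 𝐛 𝐱 𝐲) (curveʳ 𝐚 𝐛 𝐱 𝐲) on-curve)
             (λ D≈0 → D≉0 (trans (⟦⟧-cong (tangentDen 𝐚 𝐛 𝐱 𝐲) ρ≈ρ₀) D≈0))
             (substitute (𝐦 :* tangentDen 𝐚 𝐛 𝐱 𝐲) (tangentNum 𝐚 𝐛 𝐱 𝐲) slope)
             (substitute 𝐱₂ (doubleX 𝐚 𝐛 𝐱 𝐦) x₂≈))
          (+-congʳ (*-congʳ (+-congˡ (-‿cong (sym x≈)))))
    where
    ρ ρ₀ : Vec Carrier 6
    ρ  = a ∷ b ∷ x ∷ y ∷ m ∷ x₂ ∷ []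
    ρ₀ = ε + ι K (+ 16) * b ∷ b ∷ - (ι K (+ 32) * b * b) ∷ y ∷ m ∷ x₂ ∷ []

    ρ≈ρ₀ : Pointwise _≈_ ρ ρ₀
    ρ≈ρ₀ = a≈ ∷ refl ∷ x≈ ∷ refl ∷ refl ∷ refl ∷ []

    substitute : ∀ p q → ⟦ p ⟧ ρ ≈ ⟦ q ⟧ ρ → ⟦ p ⟧ ρ₀ ≈ ⟦ q ⟧ ρ₀
    substitute p q p≈q = trans (sym (⟦⟧-cong p ρ≈ρ₀)) (trans p≈q (⟦⟧-cong q ρ≈ρ₀))

    𝐚 𝐛 𝐱 𝐲 𝐦 𝐱₂ : Polynomial 6
    𝐚  = var zero
    𝐛  = var (suc zero)
    𝐱  = var (suc (suc zero))
    𝐲  = var (suc (suc (suc zero)))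
    𝐦  = var (suc (suc (suc (suc zero))))
    𝐱₂ = var (suc (suc (suc (suc (suc zero)))))

lemma4p2 : ∀ {c ℓ o : Level} (K : CommutativeRing c ℓ) → IsField K → CharZero K →
    (O : CommutativeRing.Carrier K → Set o) → IsValuationRing K O →
    (α β : ℤ) → Coprime α β →
    ¬ (β ℤ.* (α ℤ.- (+ 8) ℤ.* β) ℤ.* (α ℤ.+ (+ 8) ℤ.* β) ≡ + 0) →
    (p : ℕ) → Prime p → ¬ (2 ℕD.∣ p) → (+ p) ∣ (α ℤ.- (+ 8) ℤ.* β) →
    InMax K O (ι K (+ p)) →
    (x y : CommutativeRing.Carrier K) → OnE K α β x y →
    CommutativeRing._≈_ K x (ι K (singX K β)) →
    ReducesTo K O x y (singX K β) (singY K β) →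
    (x₂ y₂ : CommutativeRing.Carrier K) → IsDouble K α β x y x₂ y₂ →
    ¬ ReducesTo K O x₂ y₂ (singX K β) (singY K β)
lemma4p2 K K-field _ O O-valuation α β coprime _ p _ p-odd p∣ε p∈𝔪 x y on-curve x≈x₀ _ x₂ _
         (m , D≉0 , slope , x₂≈ , _) (_ , _ , x₂-x₀∈𝔪 , _) =
  residueUnit⇒∉𝔪 (residueUnit-* (residueUnit-^ 2-unit 18) (residueUnit-^ β-unit 5))
    (combination∈𝔪 x₂-x∈𝔪 (ι-divisible∈𝔪 {+ p} {α ℤ.- + 8 ℤ.* β} p∈𝔪 p∣ε) (ι∈O β)
      (doubling-eliminant a≈ε+16β (trans x≈x₀ x₀≈) on-curve D≉0 slope x₂≈))
  where
  open CommutativeRing K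
  open IntegerImage K
  open ValuationRingFacts K K-field O O-valuation
  open SingularDoubling K K-field

  2-unit : ResidueUnit (ι K (+ 2))
  2-unit = residueUnit-ι {+ p} p∈𝔪 (odd⇒2-invertible-mod p-odd)

  β-unit : ResidueUnit (ι K β)
  β-unit = residueUnit-ι {+ p} p∈𝔪 (coprime⇒invertible-mod {α} {β} {+ 8} coprime p∣ε)

  x₂-x∈𝔪 : 𝔪 (x₂ - x)
  x₂-x∈𝔪 = 𝔪-resp (+-congˡ (-‿cong (sym x≈x₀))) x₂-x₀∈𝔪

  a≈ε+16β : ι K (coeffA K α β) ≈ ι K (α ℤ.- + 8 ℤ.* β) + ι K (+ 16) * ι K β
  a≈ε+16β = begin
    ι K (α ℤ.+ + 8 ℤ.* β)                       ≡⟨ ≡.cong (ι K) (shift α β) ⟩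
    ι K ((α ℤ.- + 8 ℤ.* β) ℤ.+ + 16 ℤ.* β)      ≈⟨ ι-+ (α ℤ.- + 8 ℤ.* β) (+ 16 ℤ.* β) ⟩
    ι K (α ℤ.- + 8 ℤ.* β) + ι K (+ 16 ℤ.* β)    ≈⟨ +-congˡ (ι-* (+ 16) β) ⟩
    ι K (α ℤ.- + 8 ℤ.* β) + ι K (+ 16) * ι K β  ∎
    where
    open import Relation.Binary.Reasoning.Setoid setoid
    shift : ∀ α β → α ℤ.+ + 8 ℤ.* β ≡ (α ℤ.- + 8 ℤ.* β) ℤ.+ + 16 ℤ.* β
    shift = solve-∀

  x₀≈ : ι K (singX K β) ≈ - (ι K (+ 32) * ι K β * ι K β)
  x₀≈ = trans (ι-neg (+ 32 ℤ.* β ℤ.* β))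
              (-‿cong (trans (ι-* (+ 32 ℤ.* β) β) (*-congʳ (ι-* (+ 32) β))))
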